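{- Let $n\ge 3$ and $1\le r\le\lfloor n/2\rfloor$ be integers. The transmission of the consecutive circulant graph $\operatorname{Circ}(n,\{1,\dots,r\})$ is \[t(\operatorname{Circ}(n,\{1,\dots,r\}))=\left(\left\lfloor\frac{n-1}{2r}\right\rfloor+1\right)\left((n-1)-r\left\lfloor\frac{n-1}{2r}\right\rfloor\right).\]
   Context: For $n\ge3$ and $S\subseteq\mathbb Z_n\setminus\{0\}$, the circulant graph $\operatorname{Circ}(n,S)$ has vertex set $\mathbb Z_n$ and edges $ij$ whenever $i-j$ or $j-i$ lies in $S$. The consecutive circulant is $\operatorname{Circ}(n,\{1,2,\dots,r\})$. It is transmission regular, i.e., every vertex $v$ has the same transmission $t(v)=\sum_w d(v,w)$ (shortest-path distance), and this common value is the transmission of the graph. -}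

module Defs where

open import Data.Nat using (ℕ; zero; suc; _+_; _*_; _∸_; _≤_; _%_; _/_)
open import Data.Fin using (Fin; toℕ)
open import Data.Fin.Properties using ()
open import Data.List using (List; map; allFin)
open import Data.Nat.ListAction using (sum)
open import Data.Product using (Σ; ∃; _×_; _,_)
open import Data.Sum using (_⊎_)
open import Relation.Binary.PropositionalEquality using (_≡_)

ConsecAdj : (n r : ℕ) → Fin n → Fin n → Set
ConsecAdj zero    r () _
ConsecAdj (suc m) r i j =
  Σ ℕ λ s → (1 ≤ s) × (s ≤ r) ×
    (((toℕ i + s) % suc m ≡ toℕ j) ⊎ ((toℕ j + s) % suc m ≡ toℕ i))

data Walk (n r : ℕ) : Fin n → Fin n → ℕ → Set where
  here : ∀ {v} → Walk n r v v 0
  step : ∀ {u v w k} → ConsecAdj n r u v → Walk n r v w k → Walk n r u w (suc k)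

IsDistance : (n r : ℕ) → Fin n → Fin n → ℕ → Set
IsDistance n r v w k = Walk n r v w k × (∀ m → Walk n r v w m → k ≤ m)

HasTransmission : (n r : ℕ) → Fin n → ℕ → Set
HasTransmission n r v t =
  Σ (Fin n → ℕ) λ d → (∀ w → IsDistance n r v w (d w)) × (sum (map d (allFin n)) ≡ t)

-- floor division with the (unused here) convention m / 0 = 0
floorDiv : ℕ → ℕ → ℕ
floorDiv m zero    = 0
floorDiv m (suc k) = m / suc k

-- A step of Circ(n, {1,…,r}) moves at most r along the
-- cycle, so a walk of length k from u to w forces the shorter arc between them,
-- cycleDist n (w ⊖ u), to be at most k r; conversely, hopping r at a time along that arc
-- reaches w in ⌈arc / r⌉ steps. Hence d(u, w) = ⌈cycleDist n (w ⊖ u) / r⌉, and translating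
-- by u shows that every transmission equals ∑_{j<n} ⌈cycleDist n j / r⌉. Writing
-- n − 1 = h + (h + ε) with ε ≤ 1, the two halves of the cycle give
-- ∑_{j≤h} ⌈j/r⌉ + ∑_{j≤h+ε} ⌈j/r⌉, and for h = q r + σ with σ < r the identity
-- 2 ∑_{j≤h} ⌈j/r⌉ = (q + 1)(q r + 2σ) yields the closed form, since ⌊(n − 1) / 2r⌋ = q.

module Submission where

open import Data.Nat
open import Data.Nat.DivMod
open import Data.Nat.Properties
open import Data.Nat.Divisibility using (divides-refl)
open import Data.Nat.Induction using (<-rec)
open import Data.Nat.ListAction using (sum)
open import Data.Nat.Tactic.RingSolver using (solve-∀)
open import Data.Fin using (Fin; toℕ; fromℕ<)
open import Data.Fin.Properties using (toℕ<n; toℕ-fromℕ<; toℕ-injective)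
open import Data.List using (map; tabulate; allFin)
open import Data.List.Properties using (map-tabulate)
open import Data.Product using (Σ; _×_; _,_)
open import Data.Sum using (_⊎_; inj₁; inj₂)
open import Relation.Nullary using (yes; no)
open import Function using (_∘_; id)
open import Relation.Binary.PropositionalEquality
open ≤-Reasoning

open import Defs

≤-⊓-+-⊓ : ∀ {z a b c d} → z ≤ a + c → z ≤ a + d → z ≤ b + c → z ≤ b + d → z ≤ a ⊓ b + c ⊓ d
≤-⊓-+-⊓ {z} {a} {b} {c} {d} z≤a+c z≤a+d z≤b+c z≤b+d =
  subst (z ≤_) (sym expand) (⊓-glb (⊓-glb z≤a+c z≤b+c) (⊓-glb z≤a+d z≤b+d))
  where
  expand : a ⊓ b + c ⊓ d ≡ ((a + c) ⊓ (b + c)) ⊓ ((a + d) ⊓ (b + d))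
  expand = trans (+-distribˡ-⊓ (a ⊓ b) c d) (cong₂ _⊓_ (+-distribʳ-⊓ c a b) (+-distribʳ-⊓ d a b))

[m%n+o]%n≡[m+o]%n : ∀ m o n .{{_ : NonZero n}} → (m % n + o) % n ≡ (m + o) % n
[m%n+o]%n≡[m+o]%n m o n = begin-equality
  (m % n + o) % n            ≡⟨ %-distribˡ-+ (m % n) o n ⟩
  (m % n % n + o % n) % n    ≡⟨ cong (λ x → (x + o % n) % n) (m%n%n≡m%n m n) ⟩
  (m % n + o % n) % n        ≡⟨ %-distribˡ-+ m o n ⟨
  (m + o) % n                ∎

m∸[n+o∸m]≡[m∸n]+[m∸o] : ∀ {m n o} → n ≤ m → o ≤ m → m ≤ n + o →
                         m ∸ (n + o ∸ m) ≡ (m ∸ n) + (m ∸ o)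
m∸[n+o∸m]≡[m∸n]+[m∸o] {m} {n} {o} n≤m o≤m m≤n+o = begin-equality
  m ∸ z                        ≡⟨ cong (_∸ z) sum≡m ⟨
  (m ∸ n) + (m ∸ o) + z ∸ z    ≡⟨ m+n∸n≡m _ z ⟩
  (m ∸ n) + (m ∸ o)            ∎
  where
  z = n + o ∸ m
  sum≡m : (m ∸ n) + (m ∸ o) + z ≡ m
  sum≡m = +-cancelʳ-≡ m _ _ (begin-equality
    (m ∸ n) + (m ∸ o) + z + m       ≡⟨ regroup (m ∸ n) (m ∸ o) z m ⟩
    (m ∸ n) + (m ∸ o) + (z + m)     ≡⟨ cong ((m ∸ n) + (m ∸ o) +_) (m∸n+n≡m m≤n+o) ⟩
    (m ∸ n) + (m ∸ o) + (n + o)     ≡⟨ interchange (m ∸ n) (m ∸ o) n o ⟩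
    ((m ∸ n) + n) + ((m ∸ o) + o)   ≡⟨ cong₂ _+_ (m∸n+n≡m n≤m) (m∸n+n≡m o≤m) ⟩
    m + m                           ∎)
    where
    regroup : ∀ a b c d → a + b + c + d ≡ a + b + (c + d)
    regroup = solve-∀
    interchange : ∀ a b c d → a + b + (c + d) ≡ (a + c) + (b + d)
    interchange = solve-∀

halves : ∀ m → Σ ℕ λ h → Σ ℕ λ ε → ε ≤ 1 × h + (h + ε) ≡ m
halves zero          = 0 , 0 , z≤n , refl
halves (suc zero)    = 0 , 1 , ≤-refl , refl
halves (suc (suc m)) with halves m
... | h , ε , ε≤1 , h+[h+ε]≡m = suc h , ε , ε≤1 , cong suc (trans (+-suc h (h + ε)) (cong suc h+[h+ε]≡m))

⌈_/_⌉ : ℕ → (r : ℕ) .{{_ : NonZero r}} → ℕ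
⌈ zero  / r ⌉ = 0
⌈ suc x / r ⌉ = suc (x / r)

⌈m/n⌉≤o : ∀ {m n o} .{{_ : NonZero n}} → m ≤ o * n → ⌈ m / n ⌉ ≤ o
⌈m/n⌉≤o {zero}              _   = z≤n
⌈m/n⌉≤o {suc m} {o = suc o} m<n = m<n*o⇒m/o<n m<n

[m*n+o]/n≡m : ∀ m {n o} .{{_ : NonZero n}} → o < n → (m * n + o) / n ≡ m
[m*n+o]/n≡m m {n} {o} o<n = begin-equality
  (m * n + o) / n      ≡⟨ +-distrib-/-∣ˡ o (divides-refl m) ⟩
  m * n / n + o / n    ≡⟨ cong₂ _+_ (m*n/n≡m m n) (m<n⇒m/n≡0 o<n) ⟩
  m + 0                ≡⟨ +-identityʳ m ⟩
  m                    ∎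

floorDiv-quotient : ∀ m {n o} → o < n → floorDiv (m * n + o) n ≡ m
floorDiv-quotient m {suc n} o<n = [m*n+o]/n≡m m o<n

-- Sums over initial segments of ℕ

∑< : ℕ → (ℕ → ℕ) → ℕ
∑< zero    f = 0
∑< (suc n) f = f 0 + ∑< n (f ∘ suc)

syntax ∑< n (λ i → e) = ∑[ i < n ] e

∑<-cong : ∀ n {f g : ℕ → ℕ} → (∀ i → i < n → f i ≡ g i) → ∑< n f ≡ ∑< n g
∑<-cong zero    f≗g = refl
∑<-cong (suc n) f≗g = cong₂ _+_ (f≗g 0 z<s) (∑<-cong n (λ i i<n → f≗g (suc i) (s<s i<n)))

∑<-+ : ∀ m n (f : ℕ → ℕ) → ∑< (m + n) f ≡ ∑< m f + ∑[ i < n ] f (m + i)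
∑<-+ zero    n f = refl
∑<-+ (suc m) n f = trans (cong (f 0 +_) (∑<-+ m n (f ∘ suc))) (sym (+-assoc (f 0) _ _))

∑<-suc : ∀ n (f : ℕ → ℕ) → ∑< (suc n) f ≡ ∑< n f + f n
∑<-suc zero    f = +-identityʳ (f 0)
∑<-suc (suc n) f = trans (cong (f 0 +_) (∑<-suc n (f ∘ suc))) (sym (+-assoc (f 0) _ _))

∑<-reverse : ∀ n (f : ℕ → ℕ) → ∑[ i < n ] f (n ∸ i) ≡ ∑[ i < n ] f (suc i)
∑<-reverse zero    f = refl
∑<-reverse (suc n) f = begin-equality
  f (suc n) + ∑[ i < n ] f (n ∸ i)  ≡⟨ cong (f (suc n) +_) (∑<-reverse n f) ⟩
  f (suc n) + ∑[ i < n ] f (suc i)  ≡⟨ +-comm (f (suc n)) _ ⟩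
  ∑[ i < n ] f (suc i) + f (suc n)  ≡⟨ ∑<-suc n (f ∘ suc) ⟨
  ∑[ i < suc n ] f (suc i)          ∎

∑<-periodic-shift : ∀ n k (f : ℕ → ℕ) → (∀ i → f (i + n) ≡ f i) → ∑[ i < n ] f (i + k) ≡ ∑< n f
∑<-periodic-shift n zero    f f-periodic = ∑<-cong n (λ i _ → cong f (+-identityʳ i))
∑<-periodic-shift n (suc k) f f-periodic = begin-equality
  ∑[ i < n ] f (i + suc k)  ≡⟨ ∑<-cong n (λ i _ → cong f (+-suc i k)) ⟩
  ∑[ i < n ] g (suc i)      ≡⟨ +-cancelˡ-≡ (g 0) _ _ shift-by-one ⟩
  ∑< n g                    ≡⟨ ∑<-periodic-shift n k f f-periodic ⟩
  ∑< n f                    ∎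
  where
  g : ℕ → ℕ
  g i = f (i + k)
  shift-by-one : g 0 + ∑[ i < n ] g (suc i) ≡ g 0 + ∑< n g
  shift-by-one = begin-equality
    ∑< (suc n) g    ≡⟨ ∑<-suc n g ⟩
    ∑< n g + g n    ≡⟨ cong (∑< n g +_) (trans (cong f (+-comm n k)) (f-periodic k)) ⟩
    ∑< n g + g 0    ≡⟨ +-comm (∑< n g) (g 0) ⟩
    g 0 + ∑< n g    ∎

sum-tabulate-toℕ : ∀ n (f : ℕ → ℕ) → sum (tabulate {n = n} (f ∘ toℕ)) ≡ ∑< n f
sum-tabulate-toℕ zero    f = refl
sum-tabulate-toℕ (suc n) f = cong (f 0 +_) (sum-tabulate-toℕ n (f ∘ suc))

sum-map-allFin : ∀ n (f : ℕ → ℕ) → sum (map (f ∘ toℕ) (allFin n)) ≡ ∑< n f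
sum-map-allFin n f = trans (cong sum (map-tabulate {n = n} id (f ∘ toℕ))) (sum-tabulate-toℕ n f)

-- The distance from 0 to j on the n-cycle, for j ≤ n (beyond that n ∸ j truncates to 0).
cycleDist : ℕ → ℕ → ℕ
cycleDist n j = j ⊓ (n ∸ j)

∑-cycleDist : ∀ h ε → ε ≤ 1 → (f : ℕ → ℕ) →
  let n = suc h + (h + ε) in
  ∑[ j < n ] f (cycleDist n j) ≡ ∑[ j < suc h ] f j + ∑[ i < h + ε ] f (suc i)
∑-cycleDist h ε ε≤1 f = begin-equality
  ∑[ j < n ] f (cycleDist n j)
    ≡⟨ ∑<-+ (suc h) (h + ε) (f ∘ cycleDist n) ⟩
  ∑[ j < suc h ] f (cycleDist n j) + ∑[ i < h + ε ] f (cycleDist n (suc h + i))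
    ≡⟨ cong₂ _+_ (∑<-cong (suc h) (λ j j≤h → cong f (near j j≤h)))
                 (∑<-cong (h + ε) (λ i _ → cong f (far i))) ⟩
  ∑[ j < suc h ] f j + ∑[ i < h + ε ] f (h + ε ∸ i)
    ≡⟨ cong (∑[ j < suc h ] f j +_) (∑<-reverse (h + ε) f) ⟩
  ∑[ j < suc h ] f j + ∑[ i < h + ε ] f (suc i)
    ∎
  where
  n = suc h + (h + ε)
  near : ∀ j → j < suc h → cycleDist n j ≡ j
  near j (s≤s j≤h) = m≤n⇒m⊓n≡m (begin
    j              ≤⟨ j≤h ⟩
    h              ≤⟨ m≤m+n h ε ⟩
    h + ε          ≡⟨ m+n∸m≡n (suc h) (h + ε) ⟨
    n ∸ suc h      ≤⟨ ∸-monoʳ-≤ n (m≤n⇒m≤1+n j≤h) ⟩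
    n ∸ j          ∎)
  far : ∀ i → cycleDist n (suc h + i) ≡ h + ε ∸ i
  far i = trans (cong ((suc h + i) ⊓_) ([m+n]∸[m+o]≡n∸o (suc h) (h + ε) i))
                (m≥n⇒m⊓n≡n (begin
                  h + ε ∸ i   ≤⟨ m∸n≤m (h + ε) i ⟩
                  h + ε       ≤⟨ +-monoʳ-≤ h ε≤1 ⟩
                  h + 1       ≡⟨ +-comm h 1 ⟩
                  suc h       ≤⟨ m≤m+n (suc h) i ⟩
                  suc h + i   ∎))

module _ (r : ℕ) .{{_ : NonZero r}} where

  ceilSum : ℕ → ℕ
  ceilSum h = ∑[ i < h ] ⌈ suc i / r ⌉

  2*ceilSum : ∀ q {σ} → σ ≤ r → 2 * ceilSum (q * r + σ) ≡ suc q * (q * r + 2 * σ)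
  2*ceilSum zero    {zero}  _   = refl
  2*ceilSum (suc q) {zero}  _   = begin-equality
    2 * ceilSum (suc q * r + 0)         ≡⟨ cong (λ x → 2 * ceilSum x) (carry q r) ⟩
    2 * ceilSum (q * r + r)             ≡⟨ 2*ceilSum q ≤-refl ⟩
    suc q * (q * r + 2 * r)             ≡⟨ regroup q r ⟩
    suc (suc q) * (suc q * r + 2 * 0)   ∎
    where
    carry : ∀ q r → suc q * r + 0 ≡ q * r + r
    carry = solve-∀
    regroup : ∀ q r → suc q * (q * r + 2 * r) ≡ suc (suc q) * (suc q * r + 2 * 0)
    regroup = solve-∀
  2*ceilSum q       {suc σ} σ<r = begin-equality
    2 * ceilSum (q * r + suc σ)               ≡⟨ cong (λ x → 2 * ceilSum x) (+-suc (q * r) σ) ⟩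
    2 * ceilSum (suc h)                       ≡⟨ cong (2 *_) (∑<-suc h (λ i → ⌈ suc i / r ⌉)) ⟩
    2 * (ceilSum h + suc (h / r))             ≡⟨ cong (λ x → 2 * (ceilSum h + suc x)) ([m*n+o]/n≡m q σ<r) ⟩
    2 * (ceilSum h + suc q)                   ≡⟨ *-distribˡ-+ 2 (ceilSum h) (suc q) ⟩
    2 * ceilSum h + 2 * suc q                 ≡⟨ cong (_+ 2 * suc q) (2*ceilSum q (<⇒≤ σ<r)) ⟩
    suc q * (q * r + 2 * σ) + 2 * suc q       ≡⟨ regroup q r σ ⟩
    suc q * (q * r + 2 * suc σ)               ∎
    where
    h = q * r + σ
    regroup : ∀ q r σ → suc q * (q * r + 2 * σ) + 2 * suc q ≡ suc q * (q * r + 2 * suc σ)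
    regroup = solve-∀

  ceilSum-+ε : ∀ q {σ ε} → σ < r → ε ≤ 1 → ceilSum (q * r + σ + ε) ≡ ceilSum (q * r + σ) + ε * suc q
  ceilSum-+ε q {σ} σ<r z≤n         = trans (cong ceilSum (+-identityʳ (q * r + σ))) (sym (+-identityʳ _))
  ceilSum-+ε q {σ} σ<r (s≤s z≤n)   = begin-equality
    ceilSum (h + 1)                  ≡⟨ cong ceilSum (+-comm h 1) ⟩
    ceilSum (suc h)                  ≡⟨ ∑<-suc h (λ i → ⌈ suc i / r ⌉) ⟩
    ceilSum h + suc (h / r)          ≡⟨ cong (λ x → ceilSum h + suc x) ([m*n+o]/n≡m q σ<r) ⟩
    ceilSum h + suc q                ≡⟨ cong (ceilSum h +_) (+-identityʳ (suc q)) ⟨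
    ceilSum h + 1 * suc q            ∎
    where
    h = q * r + σ

  ∑-hops-halves : ∀ q {σ ε} → σ < r → ε ≤ 1 →
    let h = q * r + σ; m = h + (h + ε) in
    ceilSum h + ceilSum (h + ε) ≡ (floorDiv m (2 * r) + 1) * (m ∸ r * floorDiv m (2 * r))
  ∑-hops-halves q {σ} {ε} σ<r ε≤1 = begin-equality
    ceilSum h + ceilSum (h + ε)            ≡⟨ cong (ceilSum h +_) (ceilSum-+ε q σ<r ε≤1) ⟩
    ceilSum h + (ceilSum h + ε * suc q)    ≡⟨ double (ceilSum h) (ε * suc q) ⟩
    2 * ceilSum h + ε * suc q              ≡⟨ cong (_+ ε * suc q) (2*ceilSum q (<⇒≤ σ<r)) ⟩
    suc q * (q * r + 2 * σ) + ε * suc q    ≡⟨ regroup q r σ ε ⟩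
    (q + 1) * (q * r + 2 * σ + ε)          ≡⟨ cong ((q + 1) *_) (m+n∸m≡n (r * q) _) ⟨
    (q + 1) * (r * q + (q * r + 2 * σ + ε) ∸ r * q)
      ≡⟨ cong (λ x → (q + 1) * (x ∸ r * q)) (as-remainder-of-r q r σ ε) ⟨
    (q + 1) * (m ∸ r * q)
      ≡⟨ cong (λ x → (x + 1) * (m ∸ r * x)) quotient ⟨
    (floorDiv m (2 * r) + 1) * (m ∸ r * floorDiv m (2 * r)) ∎
    where
    h = q * r + σ
    m = h + (h + ε)
    double : ∀ a b → a + (a + b) ≡ 2 * a + b
    double = solve-∀
    regroup : ∀ q r σ ε → suc q * (q * r + 2 * σ) + ε * suc q ≡ (q + 1) * (q * r + 2 * σ + ε)
    regroup = solve-∀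
    as-remainder-of-r : ∀ q r σ ε → let h = q * r + σ in h + (h + ε) ≡ r * q + (q * r + 2 * σ + ε)
    as-remainder-of-r = solve-∀
    as-remainder-of-2r : ∀ q r σ ε → let h = q * r + σ in h + (h + ε) ≡ q * (2 * r) + (2 * σ + ε)
    as-remainder-of-2r = solve-∀
    2σ+ε<2r : 2 * σ + ε < 2 * r
    2σ+ε<2r = begin-strict
      2 * σ + ε      ≡⟨ +-comm (2 * σ) ε ⟩
      ε + 2 * σ      <⟨ +-monoˡ-< (2 * σ) (s≤s ε≤1) ⟩
      2 + 2 * σ      ≡⟨ *-suc 2 σ ⟨
      2 * suc σ      ≤⟨ *-monoʳ-≤ 2 σ<r ⟩
      2 * r          ∎
    quotient : floorDiv m (2 * r) ≡ q
    quotient = trans (cong (λ x → floorDiv x (2 * r)) (as-remainder-of-2r q r σ ε))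
                     (floorDiv-quotient q 2σ+ε<2r)

  ∑-hops-cycle : ∀ m →
    ∑[ j < suc m ] ⌈ cycleDist (suc m) j / r ⌉ ≡ (floorDiv m (2 * r) + 1) * (m ∸ r * floorDiv m (2 * r))
  ∑-hops-cycle m with halves m
  ... | h , ε , ε≤1 , refl = begin-equality
    ∑[ j < suc m ] ⌈ cycleDist (suc m) j / r ⌉   ≡⟨ ∑-cycleDist h ε ε≤1 (λ x → ⌈ x / r ⌉) ⟩
    ceilSum h + ceilSum (h + ε)                  ≡⟨ cong (λ x → ceilSum x + ceilSum (x + ε)) h≡q*r+σ ⟩
    ceilSum h′ + ceilSum (h′ + ε)                ≡⟨ ∑-hops-halves (h / r) (m%n<n h r) ε≤1 ⟩
    T (h′ + (h′ + ε))                            ≡⟨ cong (λ x → T (x + (x + ε))) h≡q*r+σ ⟨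
    T m                                          ∎
    where
    T : ℕ → ℕ
    T k = (floorDiv k (2 * r) + 1) * (k ∸ r * floorDiv k (2 * r))
    h′ = h / r * r + h % r
    h≡q*r+σ : h ≡ h′
    h≡q*r+σ = trans (m≡m%n+[m/n]*n h r) (+-comm (h % r) _)

-- Arithmetic modulo n

module Cyclic (n : ℕ) .{{_ : NonZero n}} where

  infixl 6 _⊕_ _⊖_

  _⊕_ : ℕ → ℕ → ℕ
  a ⊕ x = (a + x) % n

  _⊖_ : ℕ → ℕ → ℕ
  b ⊖ a = b ⊕ (n ∸ a)

  ⊖<n : ∀ b a → b ⊖ a < n
  ⊖<n b a = m%n<n (b + (n ∸ a)) n

  ⊕-assoc : ∀ a x y → a ⊕ x ⊕ y ≡ a ⊕ (x + y)
  ⊕-assoc a x y = trans ([m%n+o]%n≡[m+o]%n (a + x) y n) (cong (_% n) (+-assoc a x y))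

  ⊕-identityʳ : ∀ {a} → a < n → a ⊕ 0 ≡ a
  ⊕-identityʳ {a} a<n = trans (cong (_% n) (+-identityʳ a)) (m<n⇒m%n≡m a<n)

  ⊕-n : ∀ {a} → a < n → a ⊕ n ≡ a
  ⊕-n {a} a<n = trans ([m+n]%n≡m%n a n) (m<n⇒m%n≡m a<n)

  ⊕-∸-inverse : ∀ {a x} → a < n → x ≤ n → a ⊕ x ⊕ (n ∸ x) ≡ a
  ⊕-∸-inverse {a} {x} a<n x≤n = begin-equality
    a ⊕ x ⊕ (n ∸ x)    ≡⟨ ⊕-assoc a x (n ∸ x) ⟩
    a ⊕ (x + (n ∸ x))  ≡⟨ cong (a ⊕_) (m+[n∸m]≡n x≤n) ⟩
    a ⊕ n              ≡⟨ ⊕-n a<n ⟩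
    a                  ∎

  ⊕-⊖-cancel : ∀ {a} x → a ≤ n → a ⊕ x ⊖ a ≡ x % n
  ⊕-⊖-cancel {a} x a≤n = begin-equality
    a ⊕ x ⊕ (n ∸ a)          ≡⟨ ⊕-assoc a x (n ∸ a) ⟩
    (a + (x + (n ∸ a))) % n  ≡⟨ cong (_% n) (rearrange a x (n ∸ a)) ⟩
    (x + (a + (n ∸ a))) % n  ≡⟨ cong (λ y → (x + y) % n) (m+[n∸m]≡n a≤n) ⟩
    (x + n) % n              ≡⟨ [m+n]%n≡m%n x n ⟩
    x % n                    ∎
    where
    rearrange : ∀ a x y → a + (x + y) ≡ x + (a + y)
    rearrange = solve-∀

  ⊕-⊖ : ∀ {a b} → a ≤ n → b < n → a ⊕ (b ⊖ a) ≡ b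
  ⊕-⊖ {a} {b} a≤n b<n = begin-equality
    (a + (b + (n ∸ a)) % n) % n   ≡⟨ cong (_% n) (+-comm a _) ⟩
    ((b + (n ∸ a)) % n + a) % n   ≡⟨ [m%n+o]%n≡[m+o]%n (b + (n ∸ a)) a n ⟩
    (b + (n ∸ a) + a) % n         ≡⟨ cong (_% n) (+-assoc b (n ∸ a) a) ⟩
    b ⊕ (n ∸ a + a)               ≡⟨ cong (b ⊕_) (m∸n+n≡m a≤n) ⟩
    b ⊕ n                         ≡⟨ ⊕-n b<n ⟩
    b                             ∎

  ⊖-self : ∀ {a} → a ≤ n → a ⊖ a ≡ 0
  ⊖-self {a} a≤n = trans (cong (_% n) (m+[n∸m]≡n a≤n)) (n%n≡0 n)

  ⊖-trans : ∀ {a b c} → a < n → b < n → c < n → c ⊖ a ≡ (b ⊖ a) ⊕ (c ⊖ b)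
  ⊖-trans {a} {b} {c} a<n b<n c<n = begin-equality
    c ⊖ a                            ≡⟨ cong (_⊖ a) c≡a⊕[x+y] ⟨
    a ⊕ (x + y) ⊖ a                  ≡⟨ ⊕-⊖-cancel (x + y) (<⇒≤ a<n) ⟩
    x ⊕ y                            ∎
    where
    x = b ⊖ a
    y = c ⊖ b
    c≡a⊕[x+y] : a ⊕ (x + y) ≡ c
    c≡a⊕[x+y] = begin-equality
      a ⊕ (x + y)    ≡⟨ ⊕-assoc a x y ⟨
      a ⊕ x ⊕ y      ≡⟨ cong (_⊕ y) (⊕-⊖ (<⇒≤ a<n) b<n) ⟩
      b ⊕ y          ≡⟨ ⊕-⊖ (<⇒≤ b<n) c<n ⟩
      c              ∎

  cycleDist-⊕ : ∀ {x y} → x < n → y < n → cycleDist n (x ⊕ y) ≤ cycleDist n x + cycleDist n y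
  cycleDist-⊕ {x} {y} x<n y<n with x + y <? n
  ... | yes x+y<n = subst (λ z → cycleDist n z ≤ cycleDist n x + cycleDist n y) (sym (m<n⇒m%n≡m x+y<n))
      (≤-⊓-+-⊓ {a = x} {n ∸ x} {y} {n ∸ y}
          (m⊓n≤m (x + y) _)
          (≤-trans d≤n∸[x+y] (≤-trans (∸-monoʳ-≤ n (m≤n+m y x)) (m≤n+m (n ∸ y) x)))
          (≤-trans d≤n∸[x+y] (≤-trans (∸-monoʳ-≤ n (m≤m+n x y)) (m≤m+n (n ∸ x) y)))
          (≤-trans d≤n∸[x+y] (≤-trans (∸-monoʳ-≤ n (m≤m+n x y)) (m≤m+n (n ∸ x) (n ∸ y)))))
    where
    d≤n∸[x+y] : cycleDist n (x + y) ≤ n ∸ (x + y)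
    d≤n∸[x+y] = m⊓n≤n (x + y) _
  ... | no x+y≮n = subst (λ z → cycleDist n z ≤ cycleDist n x + cycleDist n y) z≡x⊕y
      (≤-⊓-+-⊓ {a = x} {n ∸ x} {y} {n ∸ y}
          (≤-trans d≤z (≤-trans z≤x (m≤m+n x y)))
          (≤-trans d≤z (≤-trans z≤x (m≤m+n x (n ∸ y))))
          (≤-trans d≤z (≤-trans z≤y (m≤n+m y (n ∸ x))))
          (≤-trans (m⊓n≤n z (n ∸ z))
                   (≤-reflexive (m∸[n+o∸m]≡[m∸n]+[m∸o] (<⇒≤ x<n) (<⇒≤ y<n) n≤x+y))))
    where
    n≤x+y = ≮⇒≥ x+y≮n
    z = x + y ∸ n
    d≤z : cycleDist n z ≤ z
    d≤z = m⊓n≤m z (n ∸ z)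
    z≤x : z ≤ x
    z≤x = m≤n+o⇒m∸n≤o (x + y) n (subst (_≤ n + x) (+-comm y x) (+-monoˡ-≤ x (<⇒≤ y<n)))
    z≤y : z ≤ y
    z≤y = m≤n+o⇒m∸n≤o (x + y) n (+-monoˡ-≤ y (<⇒≤ x<n))
    z≡x⊕y : z ≡ x ⊕ y
    z≡x⊕y = trans (sym (m<n⇒m%n≡m (≤-<-trans z≤x x<n))) (m≤n⇒[n∸m]%m≡n%m n≤x+y)

  cycleDist-step : ∀ {a b s} → a < n → b < n → 0 < s → s ≤ n →
                   (a ⊕ s ≡ b) ⊎ (b ⊕ s ≡ a) → cycleDist n (b ⊖ a) ≤ s
  cycleDist-step {a} {b} {s} a<n b<n 0<s s≤n (inj₁ a⊕s≡b) = begin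
    cycleDist n (b ⊖ a)      ≡⟨ cong (λ x → cycleDist n (x ⊖ a)) a⊕s≡b ⟨
    cycleDist n (a ⊕ s ⊖ a)  ≡⟨ cong (cycleDist n) (⊕-⊖-cancel s (<⇒≤ a<n)) ⟩
    cycleDist n (s % n)      ≤⟨ m⊓n≤m (s % n) _ ⟩
    s % n                    ≤⟨ m%n≤m s n ⟩
    s                        ∎
  cycleDist-step {a} {b} {s} a<n b<n 0<s s≤n (inj₂ b⊕s≡a) = begin
    cycleDist n (b ⊖ a)                ≡⟨ cong (λ x → cycleDist n (x ⊖ a)) a⊕[n∸s]≡b ⟨
    cycleDist n (a ⊕ (n ∸ s) ⊖ a)      ≡⟨ cong (cycleDist n) (⊕-⊖-cancel (n ∸ s) (<⇒≤ a<n)) ⟩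
    cycleDist n ((n ∸ s) % n)          ≡⟨ cong (cycleDist n) (m<n⇒m%n≡m (∸-monoʳ-< 0<s s≤n)) ⟩
    cycleDist n (n ∸ s)                ≤⟨ m⊓n≤n (n ∸ s) _ ⟩
    n ∸ (n ∸ s)                        ≡⟨ m∸[m∸n]≡n s≤n ⟩
    s                                  ∎
    where
    a⊕[n∸s]≡b : a ⊕ (n ∸ s) ≡ b
    a⊕[n∸s]≡b = trans (cong (_⊕ (n ∸ s)) (sym b⊕s≡a)) (⊕-∸-inverse b<n s≤n)

  ∑<-⊖ : ∀ a (f : ℕ → ℕ) → ∑[ j < n ] f (j ⊖ a) ≡ ∑< n f
  ∑<-⊖ a f = begin-equality
    ∑[ j < n ] f ((j + (n ∸ a)) % n)
      ≡⟨ ∑<-periodic-shift n (n ∸ a) (f ∘ (_% n)) (λ j → cong f ([m+n]%n≡m%n j n)) ⟩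
    ∑[ j < n ] f (j % n)
      ≡⟨ ∑<-cong n (λ j j<n → cong f (m<n⇒m%n≡m j<n)) ⟩
    ∑< n f
      ∎

-- Walks in Circ(n, {1,…,r})

ConsecAdj-sym : ∀ {n r} {u v : Fin n} → ConsecAdj n r u v → ConsecAdj n r v u
ConsecAdj-sym {suc _} (s , 1≤s , s≤r , inj₁ u+s≡v) = s , 1≤s , s≤r , inj₂ u+s≡v
ConsecAdj-sym {suc _} (s , 1≤s , s≤r , inj₂ v+s≡u) = s , 1≤s , s≤r , inj₁ v+s≡u

Walk-++ : ∀ {n r u v w k l} → Walk n r u v k → Walk n r v w l → Walk n r u w (k + l)
Walk-++ here         q = q
Walk-++ (step u~v p) q = step u~v (Walk-++ p q)

Walk-reverse : ∀ {n r u v k} → Walk n r u v k → Walk n r v u k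
Walk-reverse here                   = here
Walk-reverse {k = suc k} (step u~v p) =
  subst (Walk _ _ _ _) (+-comm k 1) (Walk-++ (Walk-reverse p) (step (ConsecAdj-sym u~v) here))

-- The order is written suc m so that ConsecAdj n r computes.
module ConsecutiveCirculant (m r : ℕ) .{{_ : NonZero r}} (r≤n : r ≤ suc m) where

  n : ℕ
  n = suc m

  open Cyclic n

  dist : Fin n → Fin n → ℕ
  dist u w = ⌈ cycleDist n (toℕ w ⊖ toℕ u) / r ⌉

  cycleDist-walk : ∀ {u w k} → Walk n r u w k → cycleDist n (toℕ w ⊖ toℕ u) ≤ k * r
  cycleDist-walk {u} here = ≤-reflexive (cong (cycleDist n) (⊖-self (<⇒≤ (toℕ<n u))))
  cycleDist-walk {u} {w} {suc k} (step {v = v} (s , 0<s , s≤r , u~v) p) = begin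
    cycleDist n (w′ ⊖ u′)
      ≡⟨ cong (cycleDist n) (⊖-trans (toℕ<n u) (toℕ<n v) (toℕ<n w)) ⟩
    cycleDist n ((v′ ⊖ u′) ⊕ (w′ ⊖ v′))
      ≤⟨ cycleDist-⊕ (⊖<n v′ u′) (⊖<n w′ v′) ⟩
    cycleDist n (v′ ⊖ u′) + cycleDist n (w′ ⊖ v′)
      ≤⟨ +-mono-≤ u→v (cycleDist-walk p) ⟩
    r + k * r
      ∎
    where
    u′ = toℕ u
    v′ = toℕ v
    w′ = toℕ w
    u→v : cycleDist n (v′ ⊖ u′) ≤ r
    u→v = ≤-trans (cycleDist-step (toℕ<n u) (toℕ<n v) 0<s (≤-trans s≤r r≤n) u~v) s≤r

  walk-⊕ : ∀ e {u w : Fin n} → toℕ u ⊕ e ≡ toℕ w → Walk n r u w ⌈ e / r ⌉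
  walk-⊕ = <-rec P hop
    where
    P : ℕ → Set
    P e = ∀ {u w : Fin n} → toℕ u ⊕ e ≡ toℕ w → Walk n r u w ⌈ e / r ⌉
    hop : ∀ e → (∀ {e′} → e′ < e → P e′) → P e
    hop zero _ {u} u⊕0≡w =
      subst (λ w → Walk n r u w 0) (toℕ-injective (trans (sym (⊕-identityʳ (toℕ<n u))) u⊕0≡w)) here
    hop (suc x) rec {u} {w} u⊕e≡w with suc x ≤? r
    ... | yes e≤r = subst (λ k → Walk n r u w (suc k)) (sym (m<n⇒m/n≡0 e≤r))
                      (step (suc x , z<s , e≤r , inj₁ u⊕e≡w) here)
    ... | no e≰r = subst (λ k → Walk n r u w (suc k)) (sym (m/n≡1+[m∸n]/n r≤x))
                     (step (r , >-nonZero⁻¹ r , ≤-refl , inj₁ (sym (toℕ-fromℕ< _)))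
                           (rec e′<e u′⊕e′≡w))
      where
      r≤x : r ≤ x
      r≤x = s≤s⁻¹ (≰⇒> e≰r)
      e′ = suc (x ∸ r)
      e′<e : e′ < suc x
      e′<e = s≤s (∸-monoʳ-< (>-nonZero⁻¹ r) r≤x)
      u′ : Fin n
      u′ = fromℕ< (m%n<n (toℕ u + r) n)
      u′⊕e′≡w : toℕ u′ ⊕ e′ ≡ toℕ w
      u′⊕e′≡w = begin-equality
        toℕ u′ ⊕ e′        ≡⟨ cong (_⊕ e′) (toℕ-fromℕ< (m%n<n (toℕ u + r) n)) ⟩
        toℕ u ⊕ r ⊕ e′     ≡⟨ ⊕-assoc (toℕ u) r e′ ⟩
        toℕ u ⊕ (r + e′)   ≡⟨ cong (toℕ u ⊕_) (trans (+-suc r (x ∸ r)) (cong suc (m+[n∸m]≡n r≤x))) ⟩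
        toℕ u ⊕ suc x      ≡⟨ u⊕e≡w ⟩
        toℕ w              ∎

  walk-dist : ∀ u w → Walk n r u w (dist u w)
  walk-dist u w = shorter-way (⊓-sel o (n ∸ o))
    where
    o = toℕ w ⊖ toℕ u
    u⊕o≡w : toℕ u ⊕ o ≡ toℕ w
    u⊕o≡w = ⊕-⊖ (<⇒≤ (toℕ<n u)) (toℕ<n w)
    w⊕[n∸o]≡u : toℕ w ⊕ (n ∸ o) ≡ toℕ u
    w⊕[n∸o]≡u = trans (cong (_⊕ (n ∸ o)) (sym u⊕o≡w))
                      (⊕-∸-inverse (toℕ<n u) (<⇒≤ (⊖<n (toℕ w) (toℕ u))))
    shorter-way : (cycleDist n o ≡ o) ⊎ (cycleDist n o ≡ n ∸ o) → Walk n r u w (dist u w)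
    shorter-way (inj₁ d≡o)   = subst (λ d → Walk n r u w ⌈ d / r ⌉) (sym d≡o)
                                     (walk-⊕ o u⊕o≡w)
    shorter-way (inj₂ d≡n∸o) = subst (λ d → Walk n r u w ⌈ d / r ⌉) (sym d≡n∸o)
                                     (Walk-reverse (walk-⊕ (n ∸ o) w⊕[n∸o]≡u))

  dist-isDistance : ∀ u w → IsDistance n r u w (dist u w)
  dist-isDistance u w = walk-dist u w , λ k p → ⌈m/n⌉≤o (cycleDist-walk p)

  hasTransmission : ∀ v → HasTransmission n r v (∑[ j < n ] ⌈ cycleDist n j / r ⌉)
  hasTransmission v = dist v , dist-isDistance v , (begin-equality
    sum (map (dist v) (allFin n))
      ≡⟨ sum-map-allFin n (λ j → ⌈ cycleDist n (j ⊖ toℕ v) / r ⌉) ⟩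
    ∑[ j < n ] ⌈ cycleDist n (j ⊖ toℕ v) / r ⌉
      ≡⟨ ∑<-⊖ (toℕ v) (λ j → ⌈ cycleDist n j / r ⌉) ⟩
    ∑[ j < n ] ⌈ cycleDist n j / r ⌉
      ∎)

proposition4p5 : (n r : ℕ) → 3 ≤ n → 1 ≤ r → r ≤ n / 2 →
    (v : Fin n) →
    HasTransmission n r v
      ((floorDiv (n ∸ 1) (2 * r) + 1) * ((n ∸ 1) ∸ r * floorDiv (n ∸ 1) (2 * r)))
proposition4p5 (suc m) r@(suc _) _ _ r≤n/2 v =
  subst (HasTransmission (suc m) r v) (∑-hops-cycle r m)
    (ConsecutiveCirculant.hasTransmission m r (≤-trans r≤n/2 (m/n≤m (suc m) 2)) v)
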